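{- Let $A\in\mathbb{F}_2[x]$ be a nonconstant odd perfect polynomial, and write $A=S^2$ with $S\in\mathbb{F}_2[x]$. Then, in $\mathbb{F}_2(x)$, $$\sum_{D\mid A,\ D\neq 1,\ D\neq A}\frac{\sigma(D)}{D}=\frac{(\sigma(S))^2}{S^2}.$$
   Context: A nonzero $A\in\mathbb{F}_2[x]$ is odd if it has no irreducible factor of degree $1$. $\sigma(A)$ is the sum of all divisors of $A$ in $\mathbb{F}_2[x]$, and $A$ is perfect if $\sigma(A)=A$. (An odd perfect polynomial is known to be a square, which is the form assumed here.) Sums over $D\mid A$ run over all divisors of $A$ in $\mathbb{F}_2[x]$. -}

module Defs where

open import Data.Bool using (Bool; true; false; _xor_; not; _∧_; if_then_else_)
open import Data.List using (List; []; _∷_; length; foldr; filter; concatMap; map)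
open import Data.Bool.ListAction using (any)
open import Data.List.Properties using (≡-dec)
open import Data.Bool.Properties using () renaming (_≟_ to _≟ᵇ_)
open import Data.Nat using (ℕ; zero; suc; _≤_)
open import Data.Product using (Σ; _×_; _,_)
open import Data.Sum using (_⊎_)
open import Relation.Nullary using (¬_)
open import Relation.Nullary.Decidable using (⌊_⌋)
open import Relation.Binary.PropositionalEquality using (_≡_)

-- Polynomials over F₂ : coefficient lists, lowest degree first.
-- A list with trailing zeros represents the same polynomial; equality of
-- polynomials is  p ≈ q  :=  norm p ≡ norm q.

Poly : Set
Poly = List Bool

norm : Poly → Poly
norm [] = []
norm (a ∷ p) = cons a (norm p)
  where
  cons : Bool → Poly → Poly
  cons false [] = []
  cons b q = b ∷ q

infix 4 _≈_
_≈_ : Poly → Poly → Set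
p ≈ q = norm p ≡ norm q

_==_ : Poly → Poly → Bool
p == q = ⌊ ≡-dec _≟ᵇ_ (norm p) (norm q) ⌋

0ₚ 1ₚ : Poly
0ₚ = []
1ₚ = true ∷ []

infixl 6 _+ₚ_
infixl 7 _*ₚ_
_+ₚ_ : Poly → Poly → Poly
[] +ₚ q = q
p@(_ ∷ _) +ₚ [] = p
(a ∷ p) +ₚ (b ∷ q) = (a xor b) ∷ (p +ₚ q)

_*ₚ_ : Poly → Poly → Poly
[] *ₚ q = []
(a ∷ p) *ₚ q = (if a then q else []) +ₚ (false ∷ (p *ₚ q))

-- size p = deg p + 1 for p ≠ 0, and size 0 = 0
size : Poly → ℕ
size p = length (norm p)

HasDegree : Poly → ℕ → Set
HasDegree p n = size p ≡ suc n

infix 4 _∣_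
_∣_ : Poly → Poly → Set
d ∣ a = Σ Poly λ c → d *ₚ c ≈ a

-- nonconstant polynomial whose only factorizations are trivial
-- (the only unit of F₂[x] is 1, i.e. the polynomials of degree 0)
Irreducible : Poly → Set
Irreducible p = (2 ≤ size p) ×
  ((q r : Poly) → q *ₚ r ≈ p → HasDegree q 0 ⊎ HasDegree r 0)

Odd : Poly → Set
Odd a = (¬ (a ≈ 0ₚ)) ×
  ((p : Poly) → HasDegree p 1 → Irreducible p → ¬ (p ∣ a))

allLists : ℕ → List Poly
allLists zero = [] ∷ []
allLists (suc n) = concatMap (λ l → (false ∷ l) ∷ (true ∷ l) ∷ []) (allLists n)

-- boolean divisibility test, valid for a ≠ 0:
-- if d * c = a ≠ 0 then deg c ≤ deg a, so c ranges over allLists (size a)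
divides? : Poly → Poly → Bool
divides? d a = any (λ c → (d *ₚ c) == a) (allLists (size a))

divisors : Poly → List Poly
divisors a = filter (λ d → Data.Bool.T? (divides? d a)) (allLists (size a))
  where import Data.Bool

σ : Poly → Poly
σ a = foldr _+ₚ_ 0ₚ (divisors a)

Perfect : Poly → Set
Perfect a = σ a ≈ a

-- Elements of F₂(x) as fractions (numerator , denominator), compared by
-- cross-multiplication.

Frac : Set
Frac = Poly × Poly

infix 4 _≃_
_≃_ : Frac → Frac → Set
(a , b) ≃ (c , d) = a *ₚ d ≈ c *ₚ b

_+f_ : Frac → Frac → Frac
(a , b) +f (c , d) = (a *ₚ d +ₚ c *ₚ b , b *ₚ d)

sumF : List Frac → Frac
sumF = foldr _+f_ (0ₚ , 1ₚ)

divisorsNonTrivial : Poly → List Poly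
divisorsNonTrivial a =
  filter (λ d → Data.Bool.T? (not (d == 1ₚ) ∧ not (d == a))) (divisors a)
  where import Data.Bool

sumSigmaOver : Poly → Frac
sumSigmaOver a = sumF (map (λ d → (σ d , d)) (divisorsNonTrivial a))

-- Multiplying through by A = S², the left-hand side becomes Σ σ(D)·(A/D) over the
-- divisors D ≠ 1, A.  The two omitted terms are both A (the second because A is
-- perfect), so in characteristic 2 they can be added back, and the full divisor sum
-- Σ_{D ∣ A} σ(D)·(A/D) equals Σ_{EFG = A} E·G.  This is symmetric in E and G, so only
-- the diagonal E = G survives: Σ_{E²F = A} E² = Σ_{E ∣ S} E² = σ(S)², since E² ∣ S²
-- iff E ∣ S and squaring is additive.
module Submission where

open import Defs
open import Algebra.Bundles using (CommutativeRing; CommutativeMonoid)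
import Algebra.Definitions
import Algebra.Properties.CommutativeSemigroup
open import Algebra.Structures using (IsCommutativeRing; IsCommutativeMonoid)
open import Data.Bool using (Bool; true; false; _xor_; not; _∧_; _∨_; if_then_else_; T?)
open import Data.Bool.Properties using (xor-same; xor-comm; xor-assoc; xor-identityʳ; T-≡; ⇔→≡)
  renaming (_≟_ to _≟ᵇ_)
open import Data.Bool.ListAction using (any)
open import Data.List using (List; []; _∷_; length; concatMap; filter; map; foldr)
open import Data.List.Properties using (≡-dec)
open import Data.List.Relation.Unary.All as All using (All; []; _∷_)
open import Data.List.Relation.Unary.Any as Any using (Any; here; there)
open import Data.List.Relation.Unary.Any.Properties using (any⁺; any⁻; concatMap⁺)
open import Data.List.Relation.Unary.All.Properties using (all-filter; filter⁺)
open import Data.Nat using (ℕ; zero; suc; _≤_; _<_; z≤n; s≤s; _+_; _≤?_)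
import Data.Nat.Properties as ℕ
open import Data.Product using (Σ; _×_; _,_; proj₁; proj₂)
open import Data.Empty using (⊥-elim)
open import Function using (_∘_; id; mk⇔; Equivalence)
open import Level using (0ℓ)
open import Relation.Nullary using (¬_; Dec; yes; no)
open import Relation.Nullary.Decidable using (⌊_⌋; map′)
open import Relation.Binary.PropositionalEquality
  using (_≡_; refl; sym; trans; cong; cong₂; subst; subst₂; module ≡-Reasoning)
open import Relation.Binary.Bundles using (Setoid)
open import Relation.Binary.Structures using (IsEquivalence)
import Relation.Binary.Reasoning.Setoid as SetoidReasoning

-- Wrapping _≈_ in a record keeps p ≋ q from unfolding to norm p ≡ norm q,
-- which would stop Agda from inferring p and q.
infix 4 _≋_
record _≋_ (p q : Poly) : Set where
  constructor ⟨_⟩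
  field ≋⇒≈ : p ≈ q
open _≋_

≋-refl : ∀ {p} → p ≋ p
≋-refl = ⟨ refl ⟩

≋-sym : ∀ {p q} → p ≋ q → q ≋ p
≋-sym ⟨ e ⟩ = ⟨ sym e ⟩

≋-trans : ∀ {p q r} → p ≋ q → q ≋ r → p ≋ r
≋-trans ⟨ e ⟩ ⟨ f ⟩ = ⟨ trans e f ⟩

≡⇒≋ : ∀ {p q} → p ≡ q → p ≋ q
≡⇒≋ refl = ≋-refl

≋-isEquivalence : IsEquivalence _≋_
≋-isEquivalence = record { refl = ≋-refl ; sym = ≋-sym ; trans = ≋-trans }

≋-setoid : Setoid 0ℓ 0ℓ
≋-setoid = record { isEquivalence = ≋-isEquivalence }

open Algebra.Definitions _≋_ using (Congruent₁)

IsZero : Poly → Set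
IsZero p = p ≋ 0ₚ

infix 4 _∣≋_
_∣≋_ : Poly → Poly → Set
d ∣≋ a = Σ Poly λ c → d *ₚ c ≋ a

coeff : Poly → ℕ → Bool
coeff [] _ = false
coeff (a ∷ p) zero = a
coeff (a ∷ p) (suc i) = coeff p i

-- the local helper of norm, which cannot be referred to from here
cons : Bool → Poly → Poly
cons false [] = []
cons b q = b ∷ q

norm-∷ : ∀ a p → norm (a ∷ p) ≡ cons a (norm p)
norm-∷ a p with norm p
norm-∷ false p | [] = refl
norm-∷ true p | [] = refl
norm-∷ false p | _ ∷ _ = refl
norm-∷ true p | _ ∷ _ = refl

∷-cong : ∀ a {p q} → p ≋ q → (a ∷ p) ≋ (a ∷ q)
∷-cong a {p} {q} ⟨ e ⟩ = ⟨ trans (norm-∷ a p) (trans (cong (cons a) e) (sym (norm-∷ a q))) ⟩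

coeff-cons : ∀ a p i → coeff (cons a p) i ≡ coeff (a ∷ p) i
coeff-cons false [] zero = refl
coeff-cons false [] (suc i) = refl
coeff-cons false (_ ∷ _) i = refl
coeff-cons true p i = refl

coeff-norm : ∀ p i → coeff (norm p) i ≡ coeff p i
coeff-norm [] i = refl
coeff-norm (a ∷ p) i rewrite norm-∷ a p with i
... | zero = coeff-cons a (norm p) zero
... | suc j = trans (coeff-cons a (norm p) (suc j)) (coeff-norm p j)

≋⇒coeff≡ : ∀ {p q} → p ≋ q → ∀ i → coeff p i ≡ coeff q i
≋⇒coeff≡ {p} {q} ⟨ e ⟩ i =
  trans (sym (coeff-norm p i)) (trans (cong (λ r → coeff r i) e) (coeff-norm q i))

coeff≡⇒≋ : ∀ p q → (∀ i → coeff p i ≡ coeff q i) → p ≋ q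
coeff≡⇒≋ [] [] h = ≋-refl
coeff≡⇒≋ [] (b ∷ q) h with h zero
... | refl = ≋-trans ⟨ refl ⟩ (∷-cong false (coeff≡⇒≋ [] q (h ∘ suc)))
coeff≡⇒≋ (a ∷ p) [] h with h zero
... | refl = ≋-trans (∷-cong false (coeff≡⇒≋ p [] (h ∘ suc))) ⟨ refl ⟩
coeff≡⇒≋ (a ∷ p) (b ∷ q) h with h zero
... | refl = ∷-cong a (coeff≡⇒≋ p q (h ∘ suc))

∷-injective : ∀ {a b p q} → (a ∷ p) ≋ (b ∷ q) → a ≡ b × p ≋ q
∷-injective e = ≋⇒coeff≡ e zero , coeff≡⇒≋ _ _ (≋⇒coeff≡ e ∘ suc)

IsZero-∷ : ∀ {a p} → IsZero (a ∷ p) → a ≡ false × IsZero p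
IsZero-∷ z = ≋⇒coeff≡ z zero , coeff≡⇒≋ _ _ (≋⇒coeff≡ z ∘ suc)

IsZero-false∷ : ∀ {p} → IsZero p → IsZero (false ∷ p)
IsZero-false∷ z = ≋-trans (∷-cong false z) ⟨ refl ⟩

-- F₂[x] is a commutative ring of characteristic 2

coeff-+ : ∀ p q i → coeff (p +ₚ q) i ≡ coeff p i xor coeff q i
coeff-+ [] q i = refl
coeff-+ (a ∷ p) [] i = sym (xor-identityʳ _)
coeff-+ (a ∷ p) (b ∷ q) zero = refl
coeff-+ (a ∷ p) (b ∷ q) (suc i) = coeff-+ p q i

+-cong : ∀ {p p' q q'} → p ≋ p' → q ≋ q' → p +ₚ q ≋ p' +ₚ q'
+-cong {p} {p'} {q} {q'} e f = coeff≡⇒≋ _ _ λ i → begin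
  coeff (p +ₚ q) i           ≡⟨ coeff-+ p q i ⟩
  coeff p i xor coeff q i    ≡⟨ cong₂ _xor_ (≋⇒coeff≡ e i) (≋⇒coeff≡ f i) ⟩
  coeff p' i xor coeff q' i  ≡⟨ coeff-+ p' q' i ⟨
  coeff (p' +ₚ q') i         ∎
  where open ≡-Reasoning

+-identityʳ : ∀ p → p +ₚ 0ₚ ≡ p
+-identityʳ [] = refl
+-identityʳ (_ ∷ _) = refl

+-comm : ∀ p q → p +ₚ q ≡ q +ₚ p
+-comm [] q = sym (+-identityʳ q)
+-comm (a ∷ p) [] = refl
+-comm (a ∷ p) (b ∷ q) = cong₂ _∷_ (xor-comm a b) (+-comm p q)

+-assoc : ∀ p q r → (p +ₚ q) +ₚ r ≡ p +ₚ (q +ₚ r)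
+-assoc [] q r = refl
+-assoc (a ∷ p) [] r = refl
+-assoc (a ∷ p) (b ∷ q) [] = refl
+-assoc (a ∷ p) (b ∷ q) (c ∷ r) = cong₂ _∷_ (xor-assoc a b c) (+-assoc p q r)

+-self : ∀ p → IsZero (p +ₚ p)
+-self p = coeff≡⇒≋ _ _ λ i → trans (coeff-+ p p i) (xor-same (coeff p i))

+-IsZeroʳ : ∀ {p} q → IsZero p → q +ₚ p ≋ q
+-IsZeroʳ {p} q z = ≋-trans (+-cong (≋-refl {q}) z) (≡⇒≋ (+-identityʳ q))

+≋0⇒≋ : ∀ {p q} → IsZero (p +ₚ q) → p ≋ q
+≋0⇒≋ {p} {q} z = coeff≡⇒≋ p q λ i →
  xor≡false⇒≡ (coeff p i) (coeff q i) (trans (sym (coeff-+ p q i)) (≋⇒coeff≡ z i))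
  where
  xor≡false⇒≡ : ∀ a b → a xor b ≡ false → a ≡ b
  xor≡false⇒≡ false false _ = refl
  xor≡false⇒≡ true true _ = refl

≋⇒+≋0 : ∀ {p q} → p ≋ q → IsZero (p +ₚ q)
≋⇒+≋0 {p} {q} e = ≋-trans (+-cong e (≋-refl {q})) (+-self q)

infixr 8 [_]·_
[_]·_ : Bool → Poly → Poly
[ b ]· p = if b then p else 0ₚ

[]·-congˡ : ∀ {b c} p → b ≡ c → [ b ]· p ≋ [ c ]· p
[]·-congˡ p refl = ≋-refl

[]·-congʳ : ∀ b {p q} → p ≋ q → [ b ]· p ≋ [ b ]· q
[]·-congʳ false e = ≋-refl
[]·-congʳ true e = e

[]·-xor : ∀ a b p → [ a xor b ]· p ≋ [ a ]· p +ₚ [ b ]· p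
[]·-xor false b p = ≋-refl
[]·-xor true false p = ≡⇒≋ (sym (+-identityʳ p))
[]·-xor true true p = ≋-sym (+-self p)

[]·-+ : ∀ b p q → [ b ]· (p +ₚ q) ≡ [ b ]· p +ₚ [ b ]· q
[]·-+ false p q = refl
[]·-+ true p q = refl

[]·-*ˡ : ∀ b p q → ([ b ]· p) *ₚ q ≡ [ b ]· (p *ₚ q)
[]·-*ˡ false p q = refl
[]·-*ˡ true p q = refl

+-isCommutativeMonoid : IsCommutativeMonoid _≋_ _+ₚ_ 0ₚ
+-isCommutativeMonoid = record
  { isMonoid = record
    { isSemigroup = record
      { isMagma = record { isEquivalence = ≋-isEquivalence ; ∙-cong = +-cong }
      ; assoc = λ p q r → ≡⇒≋ (+-assoc p q r) }
    ; identity = (λ _ → ≋-refl) , (λ p → ≡⇒≋ (+-identityʳ p)) }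
  ; comm = λ p q → ≡⇒≋ (+-comm p q) }

+-commutativeMonoid : CommutativeMonoid 0ℓ 0ℓ
+-commutativeMonoid = record { isCommutativeMonoid = +-isCommutativeMonoid }

open Algebra.Properties.CommutativeSemigroup (CommutativeMonoid.commutativeSemigroup +-commutativeMonoid)
  using () renaming (interchange to +-interchange)

module ≋-Reasoning = SetoidReasoning ≋-setoid

IsZero-*ˡ : ∀ {p} q → IsZero p → IsZero (p *ₚ q)
IsZero-*ˡ {[]} q z = ≋-refl
IsZero-*ˡ {a ∷ p} q z with IsZero-∷ {a} {p} z
... | refl , zp = IsZero-false∷ (IsZero-*ˡ q zp)

IsZero-*ʳ : ∀ q {p} → IsZero p → IsZero (q *ₚ p)
IsZero-*ʳ [] z = ≋-refl
IsZero-*ʳ (false ∷ q) z = IsZero-false∷ (IsZero-*ʳ q z)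
IsZero-*ʳ (true ∷ q) z = ≋-trans (+-IsZeroʳ _ (IsZero-false∷ (IsZero-*ʳ q z))) z

*-distribʳ : ∀ q p p' → (p +ₚ p') *ₚ q ≋ p *ₚ q +ₚ p' *ₚ q
*-distribʳ q [] p' = ≋-refl
*-distribʳ q (a ∷ p) [] = ≡⇒≋ (sym (+-identityʳ _))
*-distribʳ q (a ∷ p) (b ∷ p') = begin
  [ a xor b ]· q +ₚ (false ∷ (p +ₚ p') *ₚ q)
    ≈⟨ +-cong ([]·-xor a b q) (∷-cong false (*-distribʳ q p p')) ⟩
  ([ a ]· q +ₚ [ b ]· q) +ₚ ((false ∷ p *ₚ q) +ₚ (false ∷ p' *ₚ q))
    ≈⟨ +-interchange ([ a ]· q) ([ b ]· q) (false ∷ p *ₚ q) (false ∷ p' *ₚ q) ⟩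
  ([ a ]· q +ₚ (false ∷ p *ₚ q)) +ₚ ([ b ]· q +ₚ (false ∷ p' *ₚ q)) ∎
  where open ≋-Reasoning

*-distribˡ : ∀ q p p' → q *ₚ (p +ₚ p') ≋ q *ₚ p +ₚ q *ₚ p'
*-distribˡ [] p p' = ≋-refl
*-distribˡ (a ∷ q) p p' = begin
  [ a ]· (p +ₚ p') +ₚ (false ∷ q *ₚ (p +ₚ p'))
    ≈⟨ +-cong (≡⇒≋ ([]·-+ a p p')) (∷-cong false (*-distribˡ q p p')) ⟩
  ([ a ]· p +ₚ [ a ]· p') +ₚ ((false ∷ q *ₚ p) +ₚ (false ∷ q *ₚ p'))
    ≈⟨ +-interchange ([ a ]· p) ([ a ]· p') (false ∷ q *ₚ p) (false ∷ q *ₚ p') ⟩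
  ([ a ]· p +ₚ (false ∷ q *ₚ p)) +ₚ ([ a ]· p' +ₚ (false ∷ q *ₚ p')) ∎
  where open ≋-Reasoning

-- In characteristic 2, p ≋ p' iff p + p' ≋ 0, so congruence follows from distributivity.
*-cong : ∀ {p p' q q'} → p ≋ p' → q ≋ q' → p *ₚ q ≋ p' *ₚ q'
*-cong {p} {p'} {q} {q'} e f = ≋-trans
  (+≋0⇒≋ (≋-trans (≋-sym (*-distribʳ q p p')) (IsZero-*ˡ q (≋⇒+≋0 e))))
  (+≋0⇒≋ (≋-trans (≋-sym (*-distribˡ p' q q')) (IsZero-*ʳ p' (≋⇒+≋0 f))))

*-shift : ∀ p q → p *ₚ (false ∷ q) ≋ (false ∷ p *ₚ q)
*-shift [] q = ⟨ refl ⟩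
*-shift (false ∷ p) q = ∷-cong false (*-shift p q)
*-shift (true ∷ p) q = ∷-cong false (+-cong (≋-refl {q}) (*-shift p q))

∷-decompose : ∀ a p → (a ∷ p) ≋ [ a ]· 1ₚ +ₚ (false ∷ p)
∷-decompose false p = ≋-refl
∷-decompose true p = ≋-refl

*-identityʳ : ∀ p → p *ₚ 1ₚ ≋ p
*-identityʳ [] = ≋-refl
*-identityʳ (a ∷ p) = ≋-trans (+-cong (≋-refl {[ a ]· 1ₚ}) (∷-cong false (*-identityʳ p)))
                             (≋-sym (∷-decompose a p))

*-identityˡ : ∀ p → 1ₚ *ₚ p ≋ p
*-identityˡ p = +-IsZeroʳ p (IsZero-false∷ ≋-refl)

[]·-*ʳ : ∀ a p q → p *ₚ ([ a ]· q) ≋ [ a ]· (p *ₚ q)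
[]·-*ʳ false p q = IsZero-*ʳ p ≋-refl
[]·-*ʳ true p q = ≋-refl

[]·-square : ∀ b p → ([ b ]· p) *ₚ ([ b ]· p) ≋ [ b ]· (p *ₚ p)
[]·-square false p = ≋-refl
[]·-square true p = ≋-refl

[]·-*-[]· : ∀ b c p q → ([ b ]· p) *ₚ ([ c ]· q) ≋ [ b ]· [ c ]· (p *ₚ q)
[]·-*-[]· b c p q = ≋-trans (≡⇒≋ ([]·-*ˡ b p ([ c ]· q))) ([]·-congʳ b ([]·-*ʳ c p q))

*-comm : ∀ p q → p *ₚ q ≋ q *ₚ p
*-comm [] q = ≋-sym (IsZero-*ʳ q ≋-refl)
*-comm (a ∷ p) q = begin
  [ a ]· q +ₚ (false ∷ p *ₚ q)
    ≈⟨ +-cong (≋-sym (≋-trans ([]·-*ʳ a q 1ₚ) ([]·-congʳ a (*-identityʳ q))))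
              (∷-cong false (*-comm p q)) ⟩
  q *ₚ ([ a ]· 1ₚ) +ₚ (false ∷ q *ₚ p)  ≈⟨ +-cong (≋-refl {q *ₚ ([ a ]· 1ₚ)}) (*-shift q p) ⟨
  q *ₚ ([ a ]· 1ₚ) +ₚ q *ₚ (false ∷ p)  ≈⟨ *-distribˡ q _ _ ⟨
  q *ₚ ([ a ]· 1ₚ +ₚ (false ∷ p))       ≈⟨ *-cong (≋-refl {q}) (∷-decompose a p) ⟨
  q *ₚ (a ∷ p)                          ∎
  where open ≋-Reasoning

*-assoc : ∀ p q r → (p *ₚ q) *ₚ r ≋ p *ₚ (q *ₚ r)
*-assoc [] q r = ≋-refl
*-assoc (a ∷ p) q r = begin
  ([ a ]· q +ₚ (false ∷ p *ₚ q)) *ₚ r         ≈⟨ *-distribʳ r ([ a ]· q) _ ⟩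
  ([ a ]· q) *ₚ r +ₚ (false ∷ (p *ₚ q) *ₚ r)
    ≈⟨ +-cong (≡⇒≋ ([]·-*ˡ a q r)) (∷-cong false (*-assoc p q r)) ⟩
  [ a ]· (q *ₚ r) +ₚ (false ∷ p *ₚ (q *ₚ r))  ∎
  where open ≋-Reasoning

+-*-isCommutativeRing : IsCommutativeRing _≋_ _+ₚ_ _*ₚ_ id 0ₚ 1ₚ
+-*-isCommutativeRing = record
  { isRing = record
    { +-isAbelianGroup = record
      { isGroup = record
        { isMonoid = IsCommutativeMonoid.isMonoid +-isCommutativeMonoid
        ; inverse = +-self , +-self
        ; ⁻¹-cong = id }
      ; comm = λ p q → ≡⇒≋ (+-comm p q) }
    ; *-cong = *-cong
    ; *-assoc = *-assoc
    ; *-identity = *-identityˡ , *-identityʳ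
    ; distrib = *-distribˡ , *-distribʳ }
  ; *-comm = *-comm }

+-*-commutativeRing : CommutativeRing 0ℓ 0ℓ
+-*-commutativeRing = record { isCommutativeRing = +-*-isCommutativeRing }

open Algebra.Properties.CommutativeSemigroup (CommutativeRing.*-commutativeSemigroup +-*-commutativeRing)
  using () renaming (interchange to *-interchange; xy∙z≈zy∙x to *-swap-outer; xy∙z≈xz∙y to *-swap-inner)

+-double-cancel : ∀ a r t → (a +ₚ r) +ₚ (r +ₚ t) ≋ a +ₚ t
+-double-cancel a r t = begin
  (a +ₚ r) +ₚ (r +ₚ t)  ≡⟨ +-assoc a r (r +ₚ t) ⟩
  a +ₚ (r +ₚ (r +ₚ t))  ≡⟨ cong (a +ₚ_) (+-assoc r r t) ⟨
  a +ₚ ((r +ₚ r) +ₚ t)  ≈⟨ +-cong (≋-refl {a}) (+-cong (+-self r) (≋-refl {t})) ⟩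
  a +ₚ t                ∎
  where open ≋-Reasoning

square-+ : ∀ a b → (a +ₚ b) *ₚ (a +ₚ b) ≋ a *ₚ a +ₚ b *ₚ b
square-+ a b = begin
  (a +ₚ b) *ₚ (a +ₚ b)                         ≈⟨ *-distribʳ (a +ₚ b) a b ⟩
  a *ₚ (a +ₚ b) +ₚ b *ₚ (a +ₚ b)               ≈⟨ +-cong (*-distribˡ a a b) (*-distribˡ b a b) ⟩
  (a *ₚ a +ₚ a *ₚ b) +ₚ (b *ₚ a +ₚ b *ₚ b)
    ≈⟨ +-cong (+-cong (≋-refl {a *ₚ a}) (*-comm a b)) (≋-refl {b *ₚ a +ₚ b *ₚ b}) ⟩
  (a *ₚ a +ₚ b *ₚ a) +ₚ (b *ₚ a +ₚ b *ₚ b)     ≈⟨ +-double-cancel (a *ₚ a) (b *ₚ a) (b *ₚ b) ⟩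
  a *ₚ a +ₚ b *ₚ b                             ∎
  where open ≋-Reasoning

IsZero? : ∀ p → Dec (IsZero p)
IsZero? p = map′ ⟨_⟩ ≋⇒≈ (≡-dec _≟ᵇ_ (norm p) [])

size-cong : ∀ {p q} → p ≋ q → size p ≡ size q
size-cong ⟨ e ⟩ = cong length e

size≡0⇒IsZero : ∀ p → size p ≡ 0 → IsZero p
size≡0⇒IsZero p e with norm p in eq
... | [] = ⟨ eq ⟩

¬IsZero⇒size>0 : ∀ {p} → ¬ IsZero p → 0 < size p
¬IsZero⇒size>0 {p} nz with size p in eq
... | zero = ⊥-elim (nz (size≡0⇒IsZero p eq))
... | suc _ = s≤s z≤n

size>0⇒¬IsZero : ∀ {p} → 0 < size p → ¬ IsZero p
size>0⇒¬IsZero lt z = ℕ.<-irrefl (sym (size-cong z)) lt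

size-∷ : ∀ a {p} → ¬ IsZero p → size (a ∷ p) ≡ suc (size p)
size-∷ a {p} nz rewrite norm-∷ a p with norm p in eq
... | [] = ⊥-elim (nz ⟨ eq ⟩)
... | _ ∷ _ with a
... | false = refl
... | true = refl

size-∷-IsZero : ∀ a {p} → IsZero p → size (a ∷ p) ≤ 1
size-∷-IsZero a {p} ⟨ z ⟩ rewrite norm-∷ a p | z with a
... | false = z≤n
... | true = s≤s z≤n

size≤length : ∀ p → size p ≤ length p
size≤length [] = z≤n
size≤length (a ∷ p) with IsZero? p
... | yes z = ℕ.≤-trans (size-∷-IsZero a z) (s≤s z≤n)
... | no nz = ℕ.≤-trans (ℕ.≤-reflexive (size-∷ a nz)) (s≤s (size≤length p))

size-+ : ∀ r s → size r < size s → size (r +ₚ s) ≡ size s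
size-+ [] s lt = refl
size-+ (a ∷ r) [] ()
size-+ (a ∷ r) (b ∷ s) lt with IsZero? s
... | yes zs = size-cong (≋-trans (≡⇒≋ (+-comm (a ∷ r) (b ∷ s))) (+-IsZeroʳ (b ∷ s) ar≋0))
  where
  ar≋0 : IsZero (a ∷ r)
  ar≋0 = size≡0⇒IsZero (a ∷ r) (ℕ.n≤0⇒n≡0 (ℕ.≤-pred (ℕ.≤-trans lt (size-∷-IsZero b zs))))
... | no nzs = begin
  size ((a xor b) ∷ (r +ₚ s))  ≡⟨ size-∷ (a xor b) (size>0⇒¬IsZero {r +ₚ s} r+s>0) ⟩
  suc (size (r +ₚ s))          ≡⟨ cong suc ih ⟩
  suc (size s)                 ≡⟨ size-∷ b nzs ⟨
  size (b ∷ s)                 ∎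
  where
  open ≡-Reasoning
  r<s : size r < size s
  r<s with IsZero? r
  ... | yes zr = subst (_< size s) (sym (size-cong zr)) (¬IsZero⇒size>0 nzs)
  ... | no nzr = ℕ.≤-pred (subst₂ _<_ (size-∷ a nzr) (size-∷ b nzs) lt)
  ih : size (r +ₚ s) ≡ size s
  ih = size-+ r s r<s
  r+s>0 : 0 < size (r +ₚ s)
  r+s>0 = subst (0 <_) (sym ih) (¬IsZero⇒size>0 nzs)

size-[]· : ∀ a q → size ([ a ]· q) ≤ size q
size-[]· false q = z≤n
size-[]· true q = ℕ.≤-refl

size-true∷ : ∀ p → size (true ∷ p) ≡ suc (size p)
size-true∷ p rewrite norm-∷ true p = refl

size-* : ∀ p q → ¬ IsZero p → ¬ IsZero q → suc (size (p *ₚ q)) ≡ size p + size q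
size-* [] q nzp nzq = ⊥-elim (nzp ≋-refl)
size-* (a ∷ p) q nzp nzq with IsZero? p
size-* (false ∷ p) q nzp nzq | yes zp = ⊥-elim (nzp (IsZero-false∷ zp))
size-* (true ∷ p) q nzp nzq | yes zp = begin
  suc (size (q +ₚ (false ∷ p *ₚ q)))
    ≡⟨ cong suc (size-cong (+-IsZeroʳ q (IsZero-false∷ (IsZero-*ˡ q zp)))) ⟩
  suc (size q)                ≡⟨ cong (λ n → suc n + size q) (size-cong zp) ⟨
  suc (size p) + size q       ≡⟨ cong (_+ size q) (size-true∷ p) ⟨
  size (true ∷ p) + size q    ∎
  where open ≡-Reasoning
size-* (a ∷ p) q nzp nzq | no nzp' = begin
  suc (size ([ a ]· q +ₚ (false ∷ p *ₚ q)))  ≡⟨ cong suc (size-+ ([ a ]· q) (false ∷ p *ₚ q) aq<) ⟩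
  suc (size (false ∷ p *ₚ q))               ≡⟨ cong suc shifted ⟩
  suc (size p + size q)                     ≡⟨ cong (_+ size q) (size-∷ a nzp') ⟨
  size (a ∷ p) + size q                     ∎
  where
  open ≡-Reasoning
  ih : suc (size (p *ₚ q)) ≡ size p + size q
  ih = size-* p q nzp' nzq
  q<p+q : size q < size p + size q
  q<p+q = ℕ.+-monoˡ-≤ (size q) (¬IsZero⇒size>0 nzp')
  pq>0 : 0 < size (p *ₚ q)
  pq>0 = ℕ.≤-trans (¬IsZero⇒size>0 nzq) (ℕ.≤-pred (subst (size q <_) (sym ih) q<p+q))
  shifted : size (false ∷ p *ₚ q) ≡ size p + size q
  shifted = trans (size-∷ false (size>0⇒¬IsZero {p *ₚ q} pq>0)) ih
  aq< : size ([ a ]· q) < size (false ∷ p *ₚ q)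
  aq< = subst (size ([ a ]· q) <_) (sym shifted) (ℕ.≤-trans (s≤s (size-[]· a q)) q<p+q)

*-nonzero : ∀ {p q} → ¬ IsZero p → ¬ IsZero q → ¬ IsZero (p *ₚ q)
*-nonzero {p} {q} nzp nzq z = ℕ.<-irrefl 1≡p+q (ℕ.+-mono-≤ (¬IsZero⇒size>0 nzp) (¬IsZero⇒size>0 nzq))
  where
  1≡p+q : 1 ≡ size p + size q
  1≡p+q = trans (cong suc (sym (size-cong z))) (size-* p q nzp nzq)

*-cancelˡ : ∀ p {q r} → ¬ IsZero p → p *ₚ q ≋ p *ₚ r → q ≋ r
*-cancelˡ p {q} {r} nzp e with IsZero? (q +ₚ r)
... | yes z = +≋0⇒≋ z
... | no nz = ⊥-elim (*-nonzero nzp nz (≋-trans (*-distribˡ p q r) (≋⇒+≋0 e)))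

size≤size-*ˡ : ∀ p q → ¬ IsZero (p *ₚ q) → size p ≤ size (p *ₚ q)
size≤size-*ˡ p q nz = ℕ.≤-pred (begin
  suc (size p)       ≡⟨ ℕ.+-comm 1 (size p) ⟩
  size p + 1         ≤⟨ ℕ.+-monoʳ-≤ (size p) (¬IsZero⇒size>0 nzq) ⟩
  size p + size q    ≡⟨ size-* p q nzp nzq ⟨
  suc (size (p *ₚ q)) ∎)
  where
  open ℕ.≤-Reasoning
  nzp : ¬ IsZero p
  nzp = nz ∘ IsZero-*ˡ q
  nzq : ¬ IsZero q
  nzq = nz ∘ IsZero-*ʳ p

∣⇒size≤ : ∀ {d a} → ¬ IsZero a → d ∣≋ a → size d ≤ size a
∣⇒size≤ {d} {a} nza (c , dc≋a) =
  subst (size d ≤_) (size-cong dc≋a) (size≤size-*ˡ d c (nza ∘ ≋-trans (≋-sym dc≋a)))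

∣-nonzero : ∀ {d a} → ¬ IsZero a → d ∣≋ a → ¬ IsZero d
∣-nonzero nza (c , dc≋a) z = nza (≋-trans (≋-sym dc≋a) (IsZero-*ˡ c z))

==⇒≋ : ∀ {p q} → (p == q) ≡ true → p ≋ q
==⇒≋ {p} {q} e with ≡-dec _≟ᵇ_ (norm p) (norm q)
... | yes x = ⟨ x ⟩

≋⇒== : ∀ {p q} → p ≋ q → (p == q) ≡ true
≋⇒== {p} {q} ⟨ e ⟩ with ≡-dec _≟ᵇ_ (norm p) (norm q)
... | yes _ = refl
... | no ne = ⊥-elim (ne e)

≉⇒==false : ∀ {p q} → ¬ p ≋ q → (p == q) ≡ false
≉⇒==false {p} {q} ne with ≡-dec _≟ᵇ_ (norm p) (norm q)
... | yes x = ⊥-elim (ne ⟨ x ⟩)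
... | no _ = refl

==-cong : ∀ {p p' q q'} → p ≋ p' → q ≋ q' → (p == q) ≡ (p' == q')
==-cong ⟨ e ⟩ ⟨ f ⟩ = cong₂ (λ u v → ⌊ ≡-dec _≟ᵇ_ u v ⌋) e f

==-congˡ : ∀ {p p'} q → p ≋ p' → (p == q) ≡ (p' == q)
==-congˡ q e = ==-cong e (≋-refl {q})

==-sym : ∀ p q → (p == q) ≡ (q == p)
==-sym p q = ⇔→≡ (mk⇔ (≋⇒== {q} {p} ∘ ≋-sym ∘ ==⇒≋) (≋⇒== {p} {q} ∘ ≋-sym ∘ ==⇒≋))

∑ : List Poly → (Poly → Poly) → Poly
∑ [] f = 0ₚ
∑ (x ∷ xs) f = f x +ₚ ∑ xs f

infix 5 ∑
syntax ∑ xs (λ x → e) = ∑[ x ∈ xs ] e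

∑-cong : ∀ xs {f g} → (∀ x → f x ≋ g x) → ∑ xs f ≋ ∑ xs g
∑-cong [] h = ≋-refl
∑-cong (x ∷ xs) h = +-cong (h x) (∑-cong xs h)

∑-congᴬ : ∀ {P : Poly → Set} {xs f g} → All P xs → (∀ {x} → P x → f x ≋ g x) → ∑ xs f ≋ ∑ xs g
∑-congᴬ [] h = ≋-refl
∑-congᴬ (px ∷ pxs) h = +-cong (h px) (∑-congᴬ pxs h)

∑-zero : ∀ xs {f} → (∀ x → IsZero (f x)) → IsZero (∑ xs f)
∑-zero [] h = ≋-refl
∑-zero (x ∷ xs) h = +-cong (h x) (∑-zero xs h)

∑-zeroᴬ : ∀ {P : Poly → Set} {xs f} → All P xs → (∀ {x} → P x → IsZero (f x)) → IsZero (∑ xs f)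
∑-zeroᴬ [] h = ≋-refl
∑-zeroᴬ (px ∷ pxs) h = +-cong (h px) (∑-zeroᴬ pxs h)

∑-+ : ∀ xs f g → ∑[ x ∈ xs ] (f x +ₚ g x) ≋ ∑ xs f +ₚ ∑ xs g
∑-+ [] f g = ≋-refl
∑-+ (x ∷ xs) f g = ≋-trans (+-cong (≋-refl {f x +ₚ g x}) (∑-+ xs f g))
  (+-interchange (f x) (g x) (∑ xs f) (∑ xs g))

∑-*ˡ : ∀ c xs f → c *ₚ ∑ xs f ≋ ∑[ x ∈ xs ] (c *ₚ f x)
∑-*ˡ c [] f = IsZero-*ʳ c ≋-refl
∑-*ˡ c (x ∷ xs) f = ≋-trans (*-distribˡ c (f x) (∑ xs f)) (+-cong (≋-refl {c *ₚ f x}) (∑-*ˡ c xs f))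

∑-*ʳ : ∀ c xs f → ∑ xs f *ₚ c ≋ ∑[ x ∈ xs ] (f x *ₚ c)
∑-*ʳ c xs f = ≋-trans (*-comm (∑ xs f) c) (≋-trans (∑-*ˡ c xs f) (∑-cong xs (λ x → *-comm c (f x))))

∑-swap : ∀ xs ys (f : Poly → Poly → Poly) →
  ∑[ x ∈ xs ] ∑[ y ∈ ys ] f x y ≋ ∑[ y ∈ ys ] ∑[ x ∈ xs ] f x y
∑-swap [] ys f = ≋-sym (∑-zero ys (λ _ → ≋-refl))
∑-swap (x ∷ xs) ys f = ≋-trans (+-cong (≋-refl {∑ ys (f x)}) (∑-swap xs ys f))
  (≋-sym (∑-+ ys (f x) (λ y → ∑[ x' ∈ xs ] f x' y)))

∑∑-*-∑ : ∀ xs ys zs (p : Poly → Poly → Poly) (q : Poly → Poly) →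
  (∑[ x ∈ xs ] ∑[ y ∈ ys ] p x y) *ₚ ∑ zs q ≋ ∑[ x ∈ xs ] ∑[ y ∈ ys ] ∑[ z ∈ zs ] (p x y *ₚ q z)
∑∑-*-∑ xs ys zs p q = ≋-trans (∑-*ʳ (∑ zs q) xs _)
  (∑-cong xs (λ x → ≋-trans (∑-*ʳ (∑ zs q) ys (p x)) (∑-cong ys (λ y → ∑-*ˡ (p x y) zs q))))

∑-square : ∀ xs f → ∑ xs f *ₚ ∑ xs f ≋ ∑[ x ∈ xs ] (f x *ₚ f x)
∑-square [] f = ≋-refl
∑-square (x ∷ xs) f = ≋-trans (square-+ (f x) (∑ xs f)) (+-cong (≋-refl {f x *ₚ f x}) (∑-square xs f))

-- The off-diagonal terms f x y and f y x cancel in pairs.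
∑∑-symmetric : ∀ xs (f : Poly → Poly → Poly) → (∀ x y → f x y ≋ f y x) →
  ∑[ x ∈ xs ] ∑[ y ∈ xs ] f x y ≋ ∑[ x ∈ xs ] f x x
∑∑-symmetric [] f sym-f = ≋-refl
∑∑-symmetric (x ∷ xs) f sym-f = begin
  (f x x +ₚ ∑ xs (f x)) +ₚ (∑[ u ∈ xs ] f u x +ₚ ∑ xs (f u))
    ≈⟨ +-cong (≋-refl {f x x +ₚ ∑ xs (f x)}) (∑-+ xs (λ u → f u x) (λ u → ∑ xs (f u))) ⟩
  (f x x +ₚ ∑ xs (f x)) +ₚ ((∑[ u ∈ xs ] f u x) +ₚ (∑[ u ∈ xs ] ∑ xs (f u)))
    ≈⟨ +-cong (≋-refl {f x x +ₚ ∑ xs (f x)})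
              (+-cong (∑-cong xs (λ u → sym-f u x)) (≋-refl {∑[ u ∈ xs ] ∑ xs (f u)})) ⟩
  (f x x +ₚ ∑ xs (f x)) +ₚ (∑ xs (f x) +ₚ (∑[ u ∈ xs ] ∑ xs (f u)))
    ≈⟨ +-double-cancel (f x x) (∑ xs (f x)) _ ⟩
  f x x +ₚ (∑[ u ∈ xs ] ∑ xs (f u))
    ≈⟨ +-cong (≋-refl {f x x}) (∑∑-symmetric xs f sym-f) ⟩
  f x x +ₚ (∑[ u ∈ xs ] f u u) ∎
  where open ≋-Reasoning

∑-filter : ∀ (p : Poly → Bool) xs f → ∑ (filter (T? ∘ p) xs) f ≋ ∑[ x ∈ xs ] [ p x ]· f x
∑-filter p [] f = ≋-refl
∑-filter p (x ∷ xs) f with p x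
... | true = +-cong (≋-refl {f x}) (∑-filter p xs f)
... | false = ∑-filter p xs f

foldr-+≡∑ : ∀ xs → foldr _+ₚ_ 0ₚ xs ≡ ∑[ x ∈ xs ] x
foldr-+≡∑ [] = refl
foldr-+≡∑ (x ∷ xs) = cong (x +ₚ_) (foldr-+≡∑ xs)

hd : Poly → Bool
hd [] = false
hd (a ∷ _) = a

tl : Poly → Poly
tl [] = []
tl (_ ∷ p) = p

hd∷tl : ∀ q → (hd q ∷ tl q) ≋ q
hd∷tl [] = ⟨ refl ⟩
hd∷tl (_ ∷ _) = ≋-refl

size-tl : ∀ {m} q → size q ≤ suc m → size (tl q) ≤ m
size-tl [] le = z≤n
size-tl (c ∷ q) le with IsZero? q
... | yes z = ℕ.≤-trans (ℕ.≤-reflexive (size-cong z)) z≤n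
... | no nz = ℕ.≤-pred (subst (_≤ _) (size-∷ c nz) le)

∷-== : ∀ b c l q → ((b ∷ l) == (c ∷ q)) ≡ ⌊ b ≟ᵇ c ⌋ ∧ (l == q)
∷-== b c l q with b ≟ᵇ c
... | yes refl = ⇔→≡ (mk⇔ (≋⇒== {l} {q} ∘ proj₂ ∘ ∷-injective ∘ ==⇒≋ {b ∷ l} {b ∷ q})
                        (≋⇒== {b ∷ l} {b ∷ q} ∘ ∷-cong b ∘ ==⇒≋ {l} {q}))
... | no b≢c with (b ∷ l) == (c ∷ q) in e
...   | false = refl
...   | true = ⊥-elim (b≢c (proj₁ (∷-injective (==⇒≋ {b ∷ l} {c ∷ q} e))))

double : Poly → List Poly
double l = (false ∷ l) ∷ (true ∷ l) ∷ []

∑-allLists-suc : ∀ m f → ∑ (allLists (suc m)) f ≋ ∑[ l ∈ allLists m ] (f (false ∷ l) +ₚ f (true ∷ l))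
∑-allLists-suc m f = go (allLists m)
  where
  go : ∀ xs → ∑ (concatMap double xs) f ≋ ∑[ l ∈ xs ] (f (false ∷ l) +ₚ f (true ∷ l))
  go [] = ≋-refl
  go (l ∷ xs) = ≋-trans (≡⇒≋ (sym (+-assoc (f (false ∷ l)) (f (true ∷ l)) _)))
    (+-cong (≋-refl {f (false ∷ l) +ₚ f (true ∷ l)}) (go xs))

allLists-size : ∀ m → All (λ x → size x ≤ m) (allLists m)
allLists-size m = All.map (λ {x} e → ℕ.≤-trans (size≤length x) (ℕ.≤-reflexive e)) (allLists-length m)
  where
  allLists-length : ∀ m → All (λ x → length x ≡ m) (allLists m)
  allLists-length zero = refl ∷ []
  allLists-length (suc m) = go (allLists m) (allLists-length m)
    where
    go : ∀ xs → All (λ x → length x ≡ m) xs → All (λ x → length x ≡ suc m) (concatMap double xs)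
    go [] [] = []
    go (x ∷ xs) (px ∷ pxs) = cong suc px ∷ cong suc px ∷ go xs pxs

allLists-complete : ∀ m q → size q ≤ m → Any (_≋ q) (allLists m)
allLists-complete zero q le = here (≋-sym (size≡0⇒IsZero q (ℕ.n≤0⇒n≡0 le)))
allLists-complete (suc m) q le = concatMap⁺ double (Any.map ∈double (allLists-complete m (tl q) (size-tl q le)))
  where
  ∈double : ∀ {x} → x ≋ tl q → Any (_≋ q) (double x)
  ∈double e with hd q | hd∷tl q
  ... | false | hq = here (≋-trans (∷-cong false e) hq)
  ... | true | hq = there (here (≋-trans (∷-cong true e) hq))

∑-select : ∀ m q (H : Poly → Poly) → Congruent₁ H → size q ≤ m →
  ∑[ x ∈ allLists m ] [ x == q ]· H x ≋ H q
∑-select zero q H rH le = begin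
  [ [] == q ]· H [] +ₚ 0ₚ  ≡⟨ cong (λ b → [ b ]· H [] +ₚ 0ₚ) (≋⇒== (≋-sym q≋0)) ⟩
  H [] +ₚ 0ₚ               ≡⟨ +-identityʳ (H []) ⟩
  H []                     ≈⟨ rH (≋-sym q≋0) ⟩
  H q                      ∎
  where
  open ≋-Reasoning
  q≋0 : IsZero q
  q≋0 = size≡0⇒IsZero q (ℕ.n≤0⇒n≡0 le)
∑-select (suc m) q H rH le = begin
  ∑[ x ∈ allLists (suc m) ] [ x == q ]· H x
    ≈⟨ ∑-cong (allLists (suc m)) (λ x → []·-congˡ (H x) (==-cong (≋-refl {x}) (≋-sym (hd∷tl q)))) ⟩
  ∑[ x ∈ allLists (suc m) ] [ x == (hd q ∷ tl q) ]· H x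
    ≈⟨ ∑-allLists-suc m _ ⟩
  ∑[ l ∈ allLists m ] ([ (false ∷ l) == (hd q ∷ tl q) ]· H (false ∷ l)
                         +ₚ [ (true ∷ l) == (hd q ∷ tl q) ]· H (true ∷ l))
    ≈⟨ ∑-cong (allLists m) (select-pair (hd q)) ⟩
  ∑[ l ∈ allLists m ] [ l == tl q ]· H (hd q ∷ l)
    ≈⟨ ∑-select m (tl q) (H ∘ (hd q ∷_)) (rH ∘ ∷-cong (hd q)) (size-tl q le) ⟩
  H (hd q ∷ tl q)
    ≈⟨ rH (hd∷tl q) ⟩
  H q ∎
  where
  open ≋-Reasoning
  select-pair : ∀ c l →
    [ (false ∷ l) == (c ∷ tl q) ]· H (false ∷ l) +ₚ [ (true ∷ l) == (c ∷ tl q) ]· H (true ∷ l)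
      ≋ [ l == tl q ]· H (c ∷ l)
  select-pair c l rewrite ∷-== false c l (tl q) | ∷-== true c l (tl q) with c
  ... | false = ≡⇒≋ (+-identityʳ _)
  ... | true = ≋-refl

∑-select-absent : ∀ m q (H : Poly → Poly) → m < size q → IsZero (∑[ x ∈ allLists m ] [ x == q ]· H x)
∑-select-absent m q H lt = ∑-zeroᴬ (allLists-size m) λ {x} x≤m →
  []·-congˡ (H x) (≉⇒==false {x} {q} (λ x≋q → ℕ.<⇒≱ lt (subst (_≤ m) (size-cong x≋q) x≤m)))

[==]·-swap : ∀ (H : Poly → Poly) → Congruent₁ H → ∀ x y → [ y == x ]· H y ≋ [ x == y ]· H x
[==]·-swap H rH x y with y == x in e
... | true rewrite ==-sym x y | e = rH (==⇒≋ {y} {x} e)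
... | false rewrite ==-sym x y | e = ≋-refl

∑-allLists-extend : ∀ k m (H : Poly → Poly) → Congruent₁ H →
  (∀ x → k < size x → IsZero (H x)) → k ≤ m → ∑ (allLists k) H ≋ ∑ (allLists m) H
∑-allLists-extend k m H rH vanish k≤m = begin
  ∑ (allLists k) H
    ≈⟨ ∑-congᴬ (allLists-size k) (λ {x} x≤k → ≋-sym (∑-select m x H rH (ℕ.≤-trans x≤k k≤m))) ⟩
  ∑[ x ∈ allLists k ] ∑[ y ∈ allLists m ] [ y == x ]· H y
    ≈⟨ ∑-swap (allLists k) (allLists m) (λ x y → [ y == x ]· H y) ⟩
  ∑[ y ∈ allLists m ] ∑[ x ∈ allLists k ] [ y == x ]· H y
    ≈⟨ ∑-cong (allLists m) (λ y → ≋-trans (∑-cong (allLists k) (λ x → [==]·-swap H rH x y)) (select y)) ⟩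
  ∑ (allLists m) H ∎
  where
  open ≋-Reasoning
  select : ∀ y → ∑[ x ∈ allLists k ] [ x == y ]· H x ≋ H y
  select y with size y ≤? k
  ... | yes y≤k = ∑-select k y H rH y≤k
  ... | no y≰k = ≋-trans (∑-select-absent k y H (ℕ.≰⇒> y≰k)) (≋-sym (vanish y (ℕ.≰⇒> y≰k)))

divides?-sound : ∀ d a → divides? d a ≡ true → d ∣≋ a
divides?-sound d a e
  with Any.satisfied (any⁻ (λ c → (d *ₚ c) == a) (allLists (size a)) (Equivalence.from T-≡ e))
... | c , dc==a = c , ==⇒≋ {d *ₚ c} {a} (Equivalence.to T-≡ dc==a)

divides?-complete : ∀ d a → ¬ IsZero a → d ∣≋ a → divides? d a ≡ true
divides?-complete d a nza (c , dc≋a) = Equivalence.to T-≡ (any⁺ (λ x → (d *ₚ x) == a)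
  (Any.map (λ x≋c → Equivalence.from T-≡ (≋⇒== (≋-trans (*-cong (≋-refl {d}) x≋c) dc≋a)))
           (allLists-complete (size a) c (∣⇒size≤ {c} nza (d , ≋-trans (*-comm c d) dc≋a)))))

divides?-false : ∀ d a → ¬ IsZero a → divides? d a ≡ false → ∀ c → ((d *ₚ c) == a) ≡ false
divides?-false d a nza e c with (d *ₚ c) == a in dc==a
... | false = refl
... | true with trans (sym e) (divides?-complete d a nza (c , ==⇒≋ {d *ₚ c} {a} dc==a))
...   | ()

divides?-congˡ : ∀ {d d'} a → d ≋ d' → divides? d a ≡ divides? d' a
divides?-congˡ {d} {d'} a e = any-cong (allLists (size a))
  where
  any-cong : ∀ cs → any (λ c → (d *ₚ c) == a) cs ≡ any (λ c → (d' *ₚ c) == a) cs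
  any-cong [] = refl
  any-cong (c ∷ cs) = cong₂ _∨_ (==-congˡ a (*-cong e (≋-refl {c}))) (any-cong cs)

∑-cofactor : ∀ m {a} E {c} (H : Poly → Poly) → ¬ IsZero a → Congruent₁ H → size a ≤ m →
  E *ₚ c ≋ a → ∑[ F ∈ allLists m ] [ (E *ₚ F) == a ]· H F ≋ H c
∑-cofactor m {a} E {c} H nza rH a≤m Ec≋a =
  ≋-trans (∑-cong (allLists m) (λ F → []·-congˡ (H F) (EF==a≡F==c F)))
          (∑-select m c H rH (ℕ.≤-trans (∣⇒size≤ {c} nza (E , ≋-trans (*-comm c E) Ec≋a)) a≤m))
  where
  nzE : ¬ IsZero E
  nzE = ∣-nonzero {E} nza (c , Ec≋a)
  EF==a≡F==c : ∀ F → ((E *ₚ F) == a) ≡ (F == c)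
  EF==a≡F==c F = ⇔→≡ (mk⇔
    (λ EF==a → ≋⇒== (*-cancelˡ E nzE (≋-trans (==⇒≋ {E *ₚ F} {a} EF==a) (≋-sym Ec≋a))))
    (λ F==c → ≋⇒== (≋-trans (*-cong (≋-refl {E}) (==⇒≋ {F} {c} F==c)) Ec≋a)))

∑-divisor-indicator : ∀ m {a} E p → ¬ IsZero a → size a ≤ m →
  ∑[ F ∈ allLists m ] [ (E *ₚ F) == a ]· p ≋ [ divides? E a ]· p
∑-divisor-indicator m {a} E p nza a≤m with divides? E a in e
... | true = let c , Ec≋a = divides?-sound E a e
              in ∑-cofactor m E (λ _ → p) nza (λ _ → ≋-refl) a≤m Ec≋a
... | false = ∑-zero (allLists m) (λ F → []·-congˡ p (divides?-false E a nza e F))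

-- a ÷ d sums the (at most one) cofactor of d in a; it is 0 when d ∤ a.
infixl 7 _÷_
_÷_ : Poly → Poly → Poly
a ÷ d = ∑[ c ∈ allLists (size a) ] [ (d *ₚ c) == a ]· c

÷-cofactor : ∀ {a} d {c} → ¬ IsZero a → d *ₚ c ≋ a → a ÷ d ≋ c
÷-cofactor d nza dc≋a = ∑-cofactor _ d id nza id ℕ.≤-refl dc≋a

*-÷ : ∀ {a} d → ¬ IsZero a → d ∣≋ a → d *ₚ (a ÷ d) ≋ a
*-÷ d nza (c , dc≋a) = ≋-trans (*-cong (≋-refl {d}) (÷-cofactor d nza dc≋a)) dc≋a

÷-nondivisor : ∀ {a} d → ¬ IsZero a → divides? d a ≡ false → IsZero (a ÷ d)
÷-nondivisor {a} d nza e = ∑-zero (allLists (size a)) (λ c → []·-congˡ c (divides?-false d a nza e c))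

÷-congʳ : ∀ a {d d'} → d ≋ d' → a ÷ d ≋ a ÷ d'
÷-congʳ a e = ∑-cong (allLists (size a)) (λ c → []·-congˡ c (==-congˡ a (*-cong e (≋-refl {c}))))

-- σ a only inspects norm a.
σ-cong : ∀ {p q} → p ≋ q → σ p ≋ σ q
σ-cong ⟨ e ⟩ = ≡⇒≋ (cong σ-of-norm e)
  where
  σ-of-norm : List Bool → Poly
  σ-of-norm n = foldr _+ₚ_ 0ₚ (filter (λ d → T? (any (λ c → ⌊ ≡-dec _≟ᵇ_ (norm (d *ₚ c)) n ⌋)
                                                     (allLists (length n))))
                                      (allLists (length n)))

σ-as-∑ : ∀ m d → ¬ IsZero d → size d ≤ m → σ d ≋ ∑[ E ∈ allLists m ] [ divides? E d ]· E
σ-as-∑ m d nzd d≤m = begin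
  σ d                                              ≡⟨ foldr-+≡∑ (divisors d) ⟩
  ∑ (divisors d) id                                ≈⟨ ∑-filter (λ E → divides? E d) (allLists (size d)) id ⟩
  ∑[ E ∈ allLists (size d) ] [ divides? E d ]· E   ≈⟨ ∑-allLists-extend (size d) m _ respects vanish d≤m ⟩
  ∑[ E ∈ allLists m ] [ divides? E d ]· E          ∎
  where
  open ≋-Reasoning
  respects : Congruent₁ (λ E → [ divides? E d ]· E)
  respects {E} {E'} e = ≋-trans ([]·-congˡ E (divides?-congˡ d e)) ([]·-congʳ (divides? E' d) e)
  vanish : ∀ E → size d < size E → IsZero ([ divides? E d ]· E)
  vanish E d<E with divides? E d in e
  ... | false = ≋-refl
  ... | true = ⊥-elim (ℕ.<⇒≱ d<E (∣⇒size≤ {E} nzd (divides?-sound E d e)))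

σ-as-∑∑ : ∀ m d → ¬ IsZero d → size d ≤ m →
  σ d ≋ ∑[ E ∈ allLists m ] ∑[ F ∈ allLists m ] [ (E *ₚ F) == d ]· E
σ-as-∑∑ m d nzd d≤m = ≋-trans (σ-as-∑ m d nzd d≤m)
  (∑-cong (allLists m) (λ E → ≋-sym (∑-divisor-indicator m E E nzd d≤m)))

-- Squares: p² = p(x²) in characteristic 2

inflate : Poly → Poly
inflate [] = []
inflate (a ∷ p) = a ∷ false ∷ inflate p

evenPart oddPart : Poly → Poly
evenPart [] = []
evenPart (a ∷ p) = a ∷ oddPart p
oddPart [] = []
oddPart (a ∷ p) = evenPart p

square≋inflate : ∀ p → p *ₚ p ≋ inflate p
square≋inflate [] = ≋-refl
square≋inflate (a ∷ p) = begin
  (a ∷ p) *ₚ (a ∷ p)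
    ≈⟨ *-cong (∷-decompose a p) (∷-decompose a p) ⟩
  ([ a ]· 1ₚ +ₚ (false ∷ p)) *ₚ ([ a ]· 1ₚ +ₚ (false ∷ p))
    ≈⟨ square-+ ([ a ]· 1ₚ) (false ∷ p) ⟩
  ([ a ]· 1ₚ) *ₚ ([ a ]· 1ₚ) +ₚ (false ∷ p) *ₚ (false ∷ p)
    ≈⟨ +-cong ([]·-square a 1ₚ) (∷-cong false (≋-trans (*-shift p p) (∷-cong false (square≋inflate p)))) ⟩
  [ a ]· 1ₚ +ₚ (false ∷ false ∷ inflate p)
    ≈⟨ ∷-decompose a (false ∷ inflate p) ⟨
  (a ∷ false ∷ inflate p) ∎
  where open ≋-Reasoning

inflate-* : ∀ p q → inflate (p *ₚ q) ≋ inflate p *ₚ inflate q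
inflate-* p q = begin
  inflate (p *ₚ q)            ≈⟨ square≋inflate (p *ₚ q) ⟨
  (p *ₚ q) *ₚ (p *ₚ q)        ≈⟨ *-interchange p q p q ⟩
  (p *ₚ p) *ₚ (q *ₚ q)        ≈⟨ *-cong (square≋inflate p) (square≋inflate q) ⟩
  inflate p *ₚ inflate q      ∎
  where open ≋-Reasoning

inflate-+ : ∀ p q → inflate (p +ₚ q) ≡ inflate p +ₚ inflate q
inflate-+ [] q = refl
inflate-+ (a ∷ p) [] = refl
inflate-+ (a ∷ p) (b ∷ q) = cong (λ r → (a xor b) ∷ false ∷ r) (inflate-+ p q)

inflate-evenPart-oddPart : ∀ p → p ≋ inflate (evenPart p) +ₚ (false ∷ inflate (oddPart p))
inflate-evenPart-oddPart [] = ⟨ refl ⟩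
inflate-evenPart-oddPart (a ∷ p) = ≋-trans
  (≡⇒≋ (cong (_∷ p) (sym (xor-identityʳ a))))
  (∷-cong (a xor false) (≋-trans (inflate-evenPart-oddPart p) (≡⇒≋ (+-comm (inflate (evenPart p)) _))))

coeff-inflate-even : ∀ u i → coeff (inflate u) (i + i) ≡ coeff u i
coeff-inflate-even [] zero = refl
coeff-inflate-even [] (suc i) = refl
coeff-inflate-even (a ∷ u) zero = refl
coeff-inflate-even (a ∷ u) (suc i) rewrite ℕ.+-suc i i = coeff-inflate-even u i

coeff-inflate-odd : ∀ u i → coeff (inflate u) (suc (i + i)) ≡ false
coeff-inflate-odd [] i = refl
coeff-inflate-odd (a ∷ u) zero = refl
coeff-inflate-odd (a ∷ u) (suc i) rewrite ℕ.+-suc i i = coeff-inflate-odd u i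

inflate≋x*inflate⇒IsZero : ∀ u v → inflate u ≋ (false ∷ inflate v) → IsZero u
inflate≋x*inflate⇒IsZero u v e = coeff≡⇒≋ u [] λ i →
  trans (sym (coeff-inflate-even u i)) (trans (≋⇒coeff≡ e (i + i)) (odd-of-shifted i))
  where
  odd-of-shifted : ∀ i → coeff (false ∷ inflate v) (i + i) ≡ false
  odd-of-shifted zero = refl
  odd-of-shifted (suc i) rewrite ℕ.+-suc i i = coeff-inflate-odd v i

-- Writing C = C₀(x²) + x C₁(x²), we get S(x²) + (E C₀)(x²) = x (E C₁)(x²);
-- comparing even coefficients gives S = E C₀.
square-∣-square⇒∣ : ∀ E S → E *ₚ E ∣≋ S *ₚ S → E ∣≋ S
square-∣-square⇒∣ E S (C , E²C≋S²) =
  C₀ , ≋-sym (+≋0⇒≋ {S} {E *ₚ C₀} (inflate≋x*inflate⇒IsZero (S +ₚ E *ₚ C₀) (E *ₚ C₁) separated))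
  where
  C₀ = evenPart C
  C₁ = oddPart C
  open ≋-Reasoning
  S²-split : inflate S ≋ inflate (E *ₚ C₀) +ₚ (false ∷ inflate (E *ₚ C₁))
  S²-split = begin
    inflate S                        ≈⟨ square≋inflate S ⟨
    S *ₚ S                           ≈⟨ E²C≋S² ⟨
    (E *ₚ E) *ₚ C                    ≈⟨ *-cong (square≋inflate E) (inflate-evenPart-oddPart C) ⟩
    inflate E *ₚ (inflate C₀ +ₚ (false ∷ inflate C₁))
      ≈⟨ *-distribˡ (inflate E) _ _ ⟩
    inflate E *ₚ inflate C₀ +ₚ inflate E *ₚ (false ∷ inflate C₁)
      ≈⟨ +-cong (≋-sym (inflate-* E C₀))
                (≋-trans (*-shift (inflate E) (inflate C₁)) (∷-cong false (≋-sym (inflate-* E C₁)))) ⟩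
    inflate (E *ₚ C₀) +ₚ (false ∷ inflate (E *ₚ C₁)) ∎
  separated : inflate (S +ₚ E *ₚ C₀) ≋ (false ∷ inflate (E *ₚ C₁))
  separated = begin
    inflate (S +ₚ E *ₚ C₀)                      ≡⟨ inflate-+ S (E *ₚ C₀) ⟩
    inflate S +ₚ inflate (E *ₚ C₀)              ≈⟨ +-cong S²-split (≋-refl {inflate (E *ₚ C₀)}) ⟩
    (inflate (E *ₚ C₀) +ₚ (false ∷ inflate (E *ₚ C₁))) +ₚ inflate (E *ₚ C₀)
      ≡⟨ cong (_+ₚ inflate (E *ₚ C₀)) (+-comm (inflate (E *ₚ C₀)) _) ⟩
    ((false ∷ inflate (E *ₚ C₁)) +ₚ inflate (E *ₚ C₀)) +ₚ inflate (E *ₚ C₀)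
      ≡⟨ +-assoc (false ∷ inflate (E *ₚ C₁)) (inflate (E *ₚ C₀)) (inflate (E *ₚ C₀)) ⟩
    (false ∷ inflate (E *ₚ C₁)) +ₚ (inflate (E *ₚ C₀) +ₚ inflate (E *ₚ C₀))
      ≈⟨ +-IsZeroʳ _ (+-self (inflate (E *ₚ C₀))) ⟩
    (false ∷ inflate (E *ₚ C₁)) ∎

sumF-common-denominator : ∀ (f c : Poly → Poly) a L → All (λ d → d *ₚ c d ≋ a) L →
  sumF (map (λ d → f d , d) L) ≃ ((∑[ d ∈ L ] f d *ₚ c d) , a)
sumF-common-denominator f c a [] [] = refl
sumF-common-denominator f c a (x ∷ L) (xc≋a ∷ L-divides) = ≋⇒≈ (begin
  (f x *ₚ P +ₚ N *ₚ x) *ₚ a               ≈⟨ *-distribʳ a (f x *ₚ P) (N *ₚ x) ⟩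
  (f x *ₚ P) *ₚ a +ₚ (N *ₚ x) *ₚ a         ≈⟨ +-cong new-term old-terms ⟩
  (f x *ₚ c x) *ₚ (x *ₚ P) +ₚ Sum *ₚ (x *ₚ P) ≈⟨ *-distribʳ (x *ₚ P) (f x *ₚ c x) Sum ⟨
  (f x *ₚ c x +ₚ Sum) *ₚ (x *ₚ P)            ∎)
  where
  open ≋-Reasoning
  N P Sum : Poly
  N = proj₁ (sumF (map (λ d → f d , d) L))
  P = proj₂ (sumF (map (λ d → f d , d) L))
  Sum = ∑[ d ∈ L ] f d *ₚ c d
  ih : N *ₚ a ≋ Sum *ₚ P
  ih = ⟨ sumF-common-denominator f c a L L-divides ⟩
  new-term : (f x *ₚ P) *ₚ a ≋ (f x *ₚ c x) *ₚ (x *ₚ P)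
  new-term = begin
    (f x *ₚ P) *ₚ a             ≈⟨ *-cong (≋-refl {f x *ₚ P}) (≋-trans (≋-sym xc≋a) (*-comm x (c x))) ⟩
    (f x *ₚ P) *ₚ (c x *ₚ x)    ≈⟨ *-interchange (f x) P (c x) x ⟩
    (f x *ₚ c x) *ₚ (P *ₚ x)    ≈⟨ *-cong (≋-refl {f x *ₚ c x}) (*-comm P x) ⟩
    (f x *ₚ c x) *ₚ (x *ₚ P)    ∎
  old-terms : (N *ₚ x) *ₚ a ≋ Sum *ₚ (x *ₚ P)
  old-terms = begin
    (N *ₚ x) *ₚ a    ≈⟨ *-swap-inner N x a ⟩
    (N *ₚ a) *ₚ x    ≈⟨ *-cong ih (≋-refl {x}) ⟩
    (Sum *ₚ P) *ₚ x    ≈⟨ *-assoc Sum P x ⟩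
    Sum *ₚ (P *ₚ x)    ≈⟨ *-cong (≋-refl {Sum}) (*-comm P x) ⟩
    Sum *ₚ (x *ₚ P)    ∎

module DivisorSums {a : Poly} (nza : ¬ IsZero a) where

  U : List Poly
  U = allLists (size a)

  divides?-one : divides? 1ₚ a ≡ true
  divides?-one = divides?-complete 1ₚ a nza (a , *-identityˡ a)

  -- The terms d = 1 and d = a, being equal, cancel out.
  ∑-divisorsNonTrivial : ∀ (h : Poly → Poly) → ¬ (1ₚ ≋ a) → Congruent₁ h → h 1ₚ ≋ h a →
    ∑ (divisorsNonTrivial a) h ≋ ∑[ d ∈ U ] [ divides? d a ]· h d
  ∑-divisorsNonTrivial h 1≉a rh h1≋ha = begin
    ∑ (divisorsNonTrivial a) h
      ≈⟨ ∑-filter nontrivial (divisors a) h ⟩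
    ∑[ d ∈ divisors a ] [ nontrivial d ]· h d
      ≈⟨ ∑-filter (λ d → divides? d a) U (λ d → [ nontrivial d ]· h d) ⟩
    ∑[ d ∈ U ] [ divides? d a ]· [ nontrivial d ]· h d
      ≈⟨ ∑-cong U split ⟩
    ∑[ d ∈ U ] ([ divides? d a ]· h d +ₚ ([ d == 1ₚ ]· h d +ₚ [ d == a ]· h d))
      ≈⟨ ∑-+ U _ _ ⟩
    (∑[ d ∈ U ] [ divides? d a ]· h d) +ₚ (∑[ d ∈ U ] ([ d == 1ₚ ]· h d +ₚ [ d == a ]· h d))
      ≈⟨ +-cong (≋-refl {∑[ d ∈ U ] [ divides? d a ]· h d}) (≋-trans (∑-+ U _ _)
           (+-cong (∑-select (size a) 1ₚ h rh (¬IsZero⇒size>0 nza)) (∑-select (size a) a h rh ℕ.≤-refl))) ⟩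
    (∑[ d ∈ U ] [ divides? d a ]· h d) +ₚ (h 1ₚ +ₚ h a)
      ≈⟨ +-IsZeroʳ _ (≋⇒+≋0 h1≋ha) ⟩
    ∑[ d ∈ U ] [ divides? d a ]· h d ∎
    where
    open ≋-Reasoning
    nontrivial : Poly → Bool
    nontrivial d = not (d == 1ₚ) ∧ not (d == a)
    split : ∀ d → [ divides? d a ]· [ nontrivial d ]· h d ≋
                  [ divides? d a ]· h d +ₚ ([ d == 1ₚ ]· h d +ₚ [ d == a ]· h d)
    split d with d == 1ₚ in d==1 | d == a in d==a | divides? d a in d∣a
    ... | true | true | _ = ⊥-elim (1≉a (≋-trans (≋-sym (==⇒≋ {d} {1ₚ} d==1)) (==⇒≋ {d} {a} d==a)))
    ... | true | false | true = ≋-sym (≋-trans (≡⇒≋ (cong (h d +ₚ_) (+-identityʳ (h d)))) (+-self (h d)))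
    ... | false | true | true = ≋-sym (+-self (h d))
    ... | false | false | b = ≡⇒≋ (sym (+-identityʳ _))
    ... | true | false | false with trans (sym d∣a) (trans (divides?-congˡ a (==⇒≋ {d} {1ₚ} d==1)) divides?-one)
    ...   | ()
    split d | false | true | false
      with trans (sym d∣a) (divides?-complete d a nza (1ₚ , ≋-trans (*-identityʳ d) (==⇒≋ {d} {a} d==a)))
    ...   | ()

  σ-÷-expansion : ∀ D → [ divides? D a ]· (σ D *ₚ (a ÷ D)) ≋
    ∑[ E ∈ U ] ∑[ F ∈ U ] ∑[ G ∈ U ] [ (E *ₚ F) == D ]· [ (D *ₚ G) == a ]· (E *ₚ G)
  σ-÷-expansion D = begin
    [ divides? D a ]· (σ D *ₚ (a ÷ D))
      ≈⟨ σ-on-divisors ⟩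
    (∑[ E ∈ U ] ∑[ F ∈ U ] [ (E *ₚ F) == D ]· E) *ₚ (a ÷ D)
      ≈⟨ ∑∑-*-∑ U U U _ _ ⟩
    ∑[ E ∈ U ] ∑[ F ∈ U ] ∑[ G ∈ U ] ([ (E *ₚ F) == D ]· E) *ₚ ([ (D *ₚ G) == a ]· G)
      ≈⟨ ∑-cong U (λ E → ∑-cong U (λ F → ∑-cong U (λ G →
           []·-*-[]· ((E *ₚ F) == D) ((D *ₚ G) == a) E G))) ⟩
    ∑[ E ∈ U ] ∑[ F ∈ U ] ∑[ G ∈ U ] [ (E *ₚ F) == D ]· [ (D *ₚ G) == a ]· (E *ₚ G) ∎
    where
    open ≋-Reasoning
    σ-on-divisors : [ divides? D a ]· (σ D *ₚ (a ÷ D)) ≋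
                    (∑[ E ∈ U ] ∑[ F ∈ U ] [ (E *ₚ F) == D ]· E) *ₚ (a ÷ D)
    σ-on-divisors with divides? D a in D∣a
    ... | true = *-cong (σ-as-∑∑ (size a) D (∣-nonzero {D} nza D∣a') (∣⇒size≤ {D} nza D∣a')) (≋-refl {a ÷ D})
      where
      D∣a' : D ∣≋ a
      D∣a' = divides?-sound D a D∣a
    ... | false =
      ≋-sym (IsZero-*ʳ (∑[ E ∈ U ] ∑[ F ∈ U ] [ (E *ₚ F) == D ]· E) (÷-nondivisor D nza D∣a))

  ∑-substitute-product : ∀ E F G →
    ∑[ D ∈ U ] [ (E *ₚ F) == D ]· [ (D *ₚ G) == a ]· (E *ₚ G) ≋ [ ((E *ₚ F) *ₚ G) == a ]· (E *ₚ G)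
  ∑-substitute-product E F G = ≋-trans
    (∑-cong U (λ D → []·-congˡ (H D) (==-sym (E *ₚ F) D)))
    select-EF
    where
    H : Poly → Poly
    H D = [ (D *ₚ G) == a ]· (E *ₚ G)
    select-EF : ∑[ D ∈ U ] [ D == (E *ₚ F) ]· H D ≋ H (E *ₚ F)
    select-EF with size (E *ₚ F) ≤? size a
    ... | yes EF≤a = ∑-select (size a) (E *ₚ F) H
                       (λ e → []·-congˡ (E *ₚ G) (==-congˡ a (*-cong e (≋-refl {G})))) EF≤a
    ... | no EF≰a = ≋-trans (∑-select-absent (size a) (E *ₚ F) H (ℕ.≰⇒> EF≰a))
                      ([]·-congˡ (E *ₚ G) (sym (≉⇒==false {(E *ₚ F) *ₚ G} {a}
                        (λ e → EF≰a (∣⇒size≤ {E *ₚ F} nza (G , e))))))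

  ∑-σ-÷ : ∑[ D ∈ U ] [ divides? D a ]· (σ D *ₚ (a ÷ D)) ≋
    ∑[ E ∈ U ] ∑[ F ∈ U ] ∑[ G ∈ U ] [ ((E *ₚ F) *ₚ G) == a ]· (E *ₚ G)
  ∑-σ-÷ = begin
    ∑[ D ∈ U ] [ divides? D a ]· (σ D *ₚ (a ÷ D))
      ≈⟨ ∑-cong U σ-÷-expansion ⟩
    ∑[ D ∈ U ] ∑[ E ∈ U ] ∑[ F ∈ U ] ∑[ G ∈ U ] X D E F G
      ≈⟨ ∑-swap U U (λ D E → ∑[ F ∈ U ] ∑[ G ∈ U ] X D E F G) ⟩
    ∑[ E ∈ U ] ∑[ D ∈ U ] ∑[ F ∈ U ] ∑[ G ∈ U ] X D E F G
      ≈⟨ ∑-cong U (λ E → ∑-swap U U (λ D F → ∑[ G ∈ U ] X D E F G)) ⟩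
    ∑[ E ∈ U ] ∑[ F ∈ U ] ∑[ D ∈ U ] ∑[ G ∈ U ] X D E F G
      ≈⟨ ∑-cong U (λ E → ∑-cong U (λ F → ∑-swap U U (λ D G → X D E F G))) ⟩
    ∑[ E ∈ U ] ∑[ F ∈ U ] ∑[ G ∈ U ] ∑[ D ∈ U ] X D E F G
      ≈⟨ ∑-cong U (λ E → ∑-cong U (λ F → ∑-cong U (∑-substitute-product E F))) ⟩
    ∑[ E ∈ U ] ∑[ F ∈ U ] ∑[ G ∈ U ] [ ((E *ₚ F) *ₚ G) == a ]· (E *ₚ G) ∎
    where
    open ≋-Reasoning
    X : Poly → Poly → Poly → Poly → Poly
    X D E F G = [ (E *ₚ F) == D ]· [ (D *ₚ G) == a ]· (E *ₚ G)

  ∑-σ-÷-diagonal :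
    ∑[ D ∈ U ] [ divides? D a ]· (σ D *ₚ (a ÷ D)) ≋ ∑[ E ∈ U ] [ divides? (E *ₚ E) a ]· (E *ₚ E)
  ∑-σ-÷-diagonal = begin
    ∑[ D ∈ U ] [ divides? D a ]· (σ D *ₚ (a ÷ D))
      ≈⟨ ∑-σ-÷ ⟩
    ∑[ E ∈ U ] ∑[ F ∈ U ] ∑[ G ∈ U ] Y E F G
      ≈⟨ ∑-cong U (λ E → ∑-swap U U (Y E)) ⟩
    ∑[ E ∈ U ] ∑[ G ∈ U ] ∑[ F ∈ U ] Y E F G
      ≈⟨ ∑∑-symmetric U (λ E G → ∑[ F ∈ U ] Y E F G) (λ E G → ∑-cong U (λ F → Y-symmetric E F G)) ⟩
    ∑[ E ∈ U ] ∑[ F ∈ U ] Y E F E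
      ≈⟨ ∑-cong U (λ E → ∑-cong U (λ F → []·-congˡ (E *ₚ E) (==-congˡ a (*-swap-inner E F E)))) ⟩
    ∑[ E ∈ U ] ∑[ F ∈ U ] [ ((E *ₚ E) *ₚ F) == a ]· (E *ₚ E)
      ≈⟨ ∑-cong U (λ E → ∑-divisor-indicator (size a) (E *ₚ E) (E *ₚ E) nza ℕ.≤-refl) ⟩
    ∑[ E ∈ U ] [ divides? (E *ₚ E) a ]· (E *ₚ E) ∎
    where
    open ≋-Reasoning
    Y : Poly → Poly → Poly → Poly
    Y E F G = [ ((E *ₚ F) *ₚ G) == a ]· (E *ₚ G)
    Y-symmetric : ∀ E F G → Y E F G ≋ Y G F E
    Y-symmetric E F G = ≋-trans ([]·-congˡ (E *ₚ G) (==-congˡ a (*-swap-outer E F G)))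
                                ([]·-congʳ _ (*-comm E G))

  ∑-square-divisors : ∀ S → a ≋ S *ₚ S →
    ∑[ E ∈ U ] [ divides? (E *ₚ E) a ]· (E *ₚ E) ≋ σ S *ₚ σ S
  ∑-square-divisors S a≋S² = begin
    ∑[ E ∈ U ] [ divides? (E *ₚ E) a ]· (E *ₚ E)
      ≈⟨ ∑-cong U (λ E → []·-congˡ (E *ₚ E) (divides?-square E)) ⟩
    ∑[ E ∈ U ] [ divides? E S ]· (E *ₚ E)
      ≈⟨ ∑-cong U (λ E → []·-square (divides? E S) E) ⟨
    ∑[ E ∈ U ] ([ divides? E S ]· E) *ₚ ([ divides? E S ]· E)
      ≈⟨ ∑-square U (λ E → [ divides? E S ]· E) ⟨
    (∑[ E ∈ U ] [ divides? E S ]· E) *ₚ (∑[ E ∈ U ] [ divides? E S ]· E)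
      ≈⟨ *-cong σS σS ⟨
    σ S *ₚ σ S ∎
    where
    open ≋-Reasoning
    nzS : ¬ IsZero S
    nzS z = nza (≋-trans a≋S² (IsZero-*ˡ S z))
    σS : σ S ≋ ∑[ E ∈ U ] [ divides? E S ]· E
    σS = σ-as-∑ (size a) S nzS (∣⇒size≤ {S} nza (S , ≋-sym a≋S²))
    divides?-square : ∀ E → divides? (E *ₚ E) a ≡ divides? E S
    divides?-square E = ⇔→≡ (mk⇔ to from)
      where
      to : divides? (E *ₚ E) a ≡ true → divides? E S ≡ true
      to e with divides?-sound (E *ₚ E) a e
      ... | c , E²c≋a = divides?-complete E S nzS (square-∣-square⇒∣ E S (c , ≋-trans E²c≋a a≋S²))
      from : divides? E S ≡ true → divides? (E *ₚ E) a ≡ true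
      from e with divides?-sound E S e
      ... | c , Ec≋S = divides?-complete (E *ₚ E) a nza (c *ₚ c , (begin
        (E *ₚ E) *ₚ (c *ₚ c)  ≈⟨ *-interchange E E c c ⟩
        (E *ₚ c) *ₚ (E *ₚ c)  ≈⟨ *-cong Ec≋S Ec≋S ⟩
        S *ₚ S                ≈⟨ a≋S² ⟨
        a                     ∎))

  sumSigmaOver-≃ : ¬ (1ₚ ≋ a) → Perfect a →
    sumSigmaOver a ≃ ((∑[ d ∈ U ] [ divides? d a ]· (σ d *ₚ (a ÷ d))) , a)
  sumSigmaOver-≃ 1≉a perfect = ≋⇒≈ (begin
    N *ₚ a
      ≈⟨ ⟨ sumF-common-denominator σ (a ÷_) a (divisorsNonTrivial a) nontrivial-divide ⟩ ⟩
    ∑ (divisorsNonTrivial a) h *ₚ P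
      ≈⟨ *-cong (∑-divisorsNonTrivial h 1≉a h-respects trivial-terms) (≋-refl {P}) ⟩
    (∑[ d ∈ U ] [ divides? d a ]· h d) *ₚ P ∎)
    where
    open ≋-Reasoning
    N P : Poly
    N = proj₁ (sumSigmaOver a)
    P = proj₂ (sumSigmaOver a)
    h : Poly → Poly
    h d = σ d *ₚ (a ÷ d)
    σa≋a : σ a ≋ a
    σa≋a = ⟨ perfect ⟩
    h-respects : Congruent₁ h
    h-respects e = *-cong (σ-cong e) (÷-congʳ a e)
    trivial-terms : h 1ₚ ≋ h a
    trivial-terms = begin
      σ 1ₚ *ₚ (a ÷ 1ₚ)  ≈⟨ *-÷ 1ₚ nza (a , *-identityˡ a) ⟩
      a                 ≈⟨ *-÷ a nza (1ₚ , *-identityʳ a) ⟨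
      a *ₚ (a ÷ a)      ≈⟨ *-cong σa≋a (≋-refl {a ÷ a}) ⟨
      σ a *ₚ (a ÷ a)    ∎
    nontrivial-divide : All (λ d → d *ₚ (a ÷ d) ≋ a) (divisorsNonTrivial a)
    nontrivial-divide = All.map (λ {d} d∣a → *-÷ d nza (divides?-sound d a (Equivalence.to T-≡ d∣a)))
      (filter⁺ _ (all-filter (λ d → T? (divides? d a)) U))

corollary3p14 : (A S : Poly) → 2 ≤ size A → Odd A → Perfect A → A ≈ S *ₚ S →
    sumSigmaOver A ≃ (σ S *ₚ σ S , S *ₚ S)
corollary3p14 A S 2≤A odd perfect A≈S² = ≋⇒≈ (begin
  N *ₚ (S *ₚ S)                ≈⟨ *-cong (≋-refl {N}) (≋-sym A≋S²) ⟩
  N *ₚ A                       ≈⟨ ⟨ sumSigmaOver-≃ 1≉A perfect ⟩ ⟩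
  (∑[ d ∈ U ] [ divides? d A ]· (σ d *ₚ (A ÷ d))) *ₚ P
    ≈⟨ *-cong (≋-trans ∑-σ-÷-diagonal (∑-square-divisors S A≋S²)) (≋-refl {P}) ⟩
  (σ S *ₚ σ S) *ₚ P            ∎)
  where
  open ≋-Reasoning
  -- oddness is used only through A ≠ 0
  open DivisorSums {A} (λ z → proj₁ odd (≋⇒≈ z))
  N P : Poly
  N = proj₁ (sumSigmaOver A)
  P = proj₂ (sumSigmaOver A)
  1≉A : ¬ (1ₚ ≋ A)
  1≉A e = ℕ.<-irrefl (size-cong e) 2≤A
  A≋S² : A ≋ S *ₚ S
  A≋S² = ⟨ A≈S² ⟩
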